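{- Let $r,n\ge1$ and let $G$ be a flipped star $r$-crossing, a flipped clique $r$-crossing, or a flipped half-graph $r$-crossing of order $n$. Then $\mathrm{tww}(G)\ge n^{1/(r+1)}-2$.
   Context: Flips: for a graph $G$, partition $\mathcal{K}$ of $V(G)$ and symmetric $F\subseteq\mathcal{K}^2$, $G\oplus_{\mathcal{K}}F$ is the graph on $V(G)$ where distinct $u,v$ are adjacent iff exactly one of "$uv\in E(G)$" and "$(\mathcal{K}(u),\mathcal{K}(v))\in F$" holds. Crossings: the star $r$-crossing of order $n$ has vertices $a_1,\dots,a_n,b_1,\dots,b_n,p_{i,j,t}$ ($i,j\in[n],t\in[r]$), where for each $i,j$ the vertices $a_i,p_{i,j,1},\dots,p_{i,j,r},b_j$ form a path, and no other edges. The clique $r$-crossing additionally has edges $p_{i,j,1}p_{i,j',1}$ ($j\ne j'$) and $p_{i,j,r}p_{i',j,r}$ ($i\ne i'$). The half-graph $r$-crossing is like the star $r$-crossing except $a_i$ is adjacent to $p_{i',j,1}$ for all $i\le i'$, all $j$, and $b_j$ to $p_{i,j',r}$ for all $i$ and $j\le j'$. Layers: $L_0=\{a_i\}$, $L_t=\{p_{i,j,t}\}$, $L_{r+1}=\{b_j\}$. A flipped crossing is $H\oplus_{\mathcal{L}}F$ for such a crossing $H$, the layer partition $\mathcal{L}$ and any symmetric $F\subseteq\mathcal{L}^2$. Twin-width: a contraction sequence of an $n$-vertex graph $G$ is a sequence of partitions from the partition into singletons to $\{V(G)\}$, each obtained from the previous by merging two parts. The red-degree of a part $P$ is the number of other parts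 $Q$ such that $P$ and $Q$ are neither fully adjacent nor fully non-adjacent; $\mathrm{tww}(G)$ is the least $d$ such that some contraction sequence has all red-degrees at most $d$. -}

module Defs where

open import Data.Nat using (ℕ; zero; suc; _+_; _≤_)
open import Data.Fin using (Fin; toℕ; inject₁; fromℕ) renaming (zero to fz; suc to fs)
import Data.Fin as F
open import Data.Bool using (Bool; true; false; _∧_; _∨_; not; _xor_; if_then_else_)
open import Data.List using (List; length; filterᵇ)
open import Data.Bool.ListAction using (any)
open import Data.Product using (Σ; _×_; _,_)
open import Data.Sum using (_⊎_)
open import Relation.Binary.PropositionalEquality using (_≡_; _≢_)
open import Relation.Nullary.Decidable using (⌊_⌋)
open import Function.Bundles using (_⇔_; _⤖_; Bijection)
open import Function.Definitions using (Injective)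
import Data.List as L

-- Simple graphs on Fin N, adjacency as a Bool-valued function
-- (only its values on distinct vertices matter below).

-- (The graphs we apply this to are symmetric and loopless by construction.)
Graph : ℕ → Set
Graph N = Fin N → Fin N → Bool

adj : ∀ {N} → Graph N → Fin N → Fin N → Bool
adj G = G

-- Twin-width.
-- A partition of Fin N is given by a labelling  P : Fin N → Fin N ;
-- its parts are the non-empty fibres  { u | P u ≡ ℓ }.

Labelling : ℕ → Set
Labelling N = Fin N → Fin N

IsDiscrete : ∀ {N} → Labelling N → Set
IsDiscrete P = Injective _≡_ _≡_ P

IsTrivial : ∀ {N} → Labelling N → Set
IsTrivial P = ∀ u v → P u ≡ P v

MergeStep : ∀ {N} → Labelling N → Labelling N → Set
MergeStep {N} P Q =
  Σ (Fin N) λ x → Σ (Fin N) λ y → (P x ≢ P y) ×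
    (∀ u v → (Q u ≡ Q v) ⇔
       ((P u ≡ P v) ⊎ ((P u ≡ P x) × (P v ≡ P y)) ⊎ ((P u ≡ P y) × (P v ≡ P x))))

_==_ : ∀ {N} → Fin N → Fin N → Bool
i == j = ⌊ i F.≟ j ⌋

allV : (N : ℕ) → List (Fin N)
allV N = L.allFin N

isRed : ∀ {N} → Graph N → Labelling N → Fin N → Fin N → Bool
isRed {N} G P ℓ m =
  not (ℓ == m) ∧
  (any (λ u → any (λ v → (P u == ℓ) ∧ (P v == m) ∧ adj G u v) (allV N)) (allV N) ∧
   any (λ u → any (λ v → (P u == ℓ) ∧ (P v == m) ∧ not (adj G u v)) (allV N)) (allV N))

-- red-degree of the part with label ℓ (0 if that part is empty)
redDeg : ∀ {N} → Graph N → Labelling N → Fin N → ℕ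
redDeg {N} G P ℓ = length (filterᵇ (isRed G P ℓ) (allV N))

record ContractionSeq {N : ℕ} (G : Graph N) (d : ℕ) : Set where
  field
    len      : ℕ
    part     : Fin (suc len) → Labelling N
    start    : IsDiscrete (part fz)
    finish   : IsTrivial (part (fromℕ len))
    steps    : ∀ (s : Fin len) → MergeStep (part (inject₁ s)) (part (fs s))
    redBound : ∀ (s : Fin (suc len)) (ℓ : Fin N) → redDeg G (part s) ℓ ≤ d

TwwAtMost : ∀ {N} → Graph N → ℕ → Set
TwwAtMost G d = ContractionSeq G d

data CV (n r : ℕ) : Set where
  a : Fin n → CV n r
  b : Fin n → CV n r
  p : Fin n → Fin n → Fin r → CV n r     -- p i j t  (t = 0 … r-1 stands for t = 1 … r)

data Kind : Set where
  star clique halfgraph : Kind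

isFirst : ∀ {r} → Fin r → Bool
isFirst t = ⌊ toℕ t Data.Nat.≟ 0 ⌋

isLast : ∀ {r} → Fin r → Bool
isLast {r} t = ⌊ suc (toℕ t) Data.Nat.≟ r ⌋

leF : ∀ {n} → Fin n → Fin n → Bool
leF i j = ⌊ i F.≤? j ⌋

succF : ∀ {r} → Fin r → Fin r → Bool
succF t t' = ⌊ suc (toℕ t) Data.Nat.≟ toℕ t' ⌋

edge→ : ∀ {n r} → Kind → CV n r → CV n r → Bool
edge→ star      (a i) (p i' j t) = (i == i') ∧ isFirst t
edge→ clique    (a i) (p i' j t) = (i == i') ∧ isFirst t
edge→ halfgraph (a i) (p i' j t) = leF i i' ∧ isFirst t
edge→ star      (b j) (p i j' t) = (j == j') ∧ isLast t
edge→ clique    (b j) (p i j' t) = (j == j') ∧ isLast t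
edge→ halfgraph (b j) (p i j' t) = leF j j' ∧ isLast t
edge→ star      (p i j t) (p i' j' t') = (i == i') ∧ (j == j') ∧ succF t t'
edge→ halfgraph (p i j t) (p i' j' t') = (i == i') ∧ (j == j') ∧ succF t t'
edge→ clique    (p i j t) (p i' j' t') =
  ((i == i') ∧ (j == j') ∧ succF t t') ∨
  ((i == i') ∧ not (j == j') ∧ isFirst t ∧ isFirst t') ∨
  ((j == j') ∧ not (i == i') ∧ isLast t ∧ isLast t')
edge→ _ _ _ = false

crossAdj : ∀ {n r} → Kind → CV n r → CV n r → Bool
crossAdj k u v = edge→ k u v ∨ edge→ k v u

layer : ∀ {n r} → CV n r → Fin (suc (suc r))
layer (a i) = fz
layer {r = r} (b j) = fromℕ (suc r)
layer (p i j t) = fs (inject₁ t)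

SymmetricF : ∀ {r} → (Fin (suc (suc r)) → Fin (suc (suc r)) → Bool) → Set
SymmetricF {r} Fl = ∀ (K K' : Fin (suc (suc r))) → Fl K K' ≡ Fl K' K

-- the flipped crossing H ⊕_L F, transported to Fin N along a bijection
-- e : Fin N ⤖ V(H)
flippedAdj : ∀ {n r N} → Kind → (Fin (suc (suc r)) → Fin (suc (suc r)) → Bool) →
             (Fin N ⤖ CV n r) → Fin N → Fin N → Bool
flippedAdj k Fl e u v =
  if u == v then false
  else (crossAdj k (Bijection.to e u) (Bijection.to e v) xor
        Fl (layer (Bijection.to e u)) (layer (Bijection.to e v)))

{-# OPTIONS --safe #-}
-- Take the first contraction after which two a's, or two b's, share a part; say a_i and a_i'
-- with i < i' (for two b's run the same argument down a column instead of along a row).  Just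
-- before it the b's lie in distinct parts, so afterwards each part holds at most two b's and
-- only the merged part holds two.  Let N[ℓ] be the part ℓ together with its red neighbours, at
-- most d + 1 parts.  If two vertices of one part disagree on z, the part of z lies in N of
-- their part.  Along row i, p_{i,j',t} and p_{i,j,t} (j' < j) disagree on p_{i,j,t+1} (on b_j
-- for t = r), and a_i, a_i' disagree on every p_{i,j,1}; flipping pairs of layers keeps these
-- disagreements, as the two vertices compared lie in one layer.  So N[ℓ] meets the parts of at
-- most d + 2 of the b's, and each level up the row multiplies this cap by at most d + 2: among
-- the level-t vertices in one part, all but the first have their successor in N of that part.
-- Level 1 lies entirely in N of the part of a_i, whence n ≤ (d + 2)^(r + 1).
module Submission where

open import Defs

open import Data.Bool using (Bool; true; false; _∧_; _∨_; not; _xor_; T)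
open import Data.Bool.ListAction using (any)
open import Data.Bool.Properties using (∧-distribˡ-∨; ∧-identityʳ; ∧-zeroʳ; ∨-comm; not-¬)
open import Data.Empty using (⊥-elim)
open import Data.Fin as F using (Fin; toℕ)
import Data.Fin.Properties as FP
open import Data.List using (List; []; _∷_; length; filterᵇ; allFin)
open import Data.List.Membership.Propositional using (_∈_; lose)
open import Data.List.Membership.Propositional.Properties using (∈-allFin; ∈-filter⁺)
open import Data.List.Properties using (length-tabulate)
open import Data.List.Relation.Unary.All using () renaming (lookup to lookupAll)
open import Data.List.Relation.Unary.AllPairs using (_∷_)
open import Data.List.Relation.Unary.Any using (here; there)
open import Data.List.Relation.Unary.Any.Properties using (any⁺)
open import Data.List.Relation.Unary.Unique.Propositional using (Unique)
open import Data.List.Relation.Unary.Unique.Propositional.Properties using (allFin⁺)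
open import Data.Nat as ℕ using (ℕ; zero; suc; z≤n; s≤s; z<s; _+_; _*_; _^_; _≤_)
open import Data.Nat.Properties
  using (module ≤-Reasoning; ≤-refl; ≤-reflexive; ≤-trans; <-trans; <-irrefl; <⇒≱;
         n≤1+n; n<1+n; m≤n⇒m≤1+n; m≤n+m; m≤m*n; 1+n≢n; 1+n≢0; +-comm; +-suc; +-identityʳ;
         +-mono-≤; +-monoˡ-≤; *-suc; *-identityʳ; *-monoˡ-≤; m^n≢0; m^n>0)
open import Data.Product using (_×_; _,_; proj₁; proj₂; ∃; ∃₂)
open import Data.Sum using (_⊎_; inj₁; inj₂; [_,_])
open import Data.Unit using (tt)
open import Function.Base using (_∘_; id)
open import Function.Bundles using (Equivalence; Bijection; Surjection; _⤖_)
open import Relation.Binary.Definitions using (DecidableEquality; tri<; tri≈; tri>)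
open import Relation.Binary.PropositionalEquality
  using (_≡_; _≢_; refl; sym; trans; cong; cong₂; subst; ≢-sym)
open import Relation.Nullary using (Dec; yes; no; ¬_)
open import Relation.Nullary.Decidable
  using (⌊_⌋; T?; isYes≗does; dec-true; dec-false; fromWitness; fromWitnessFalse; toWitness;
         toWitnessFalse; _×-dec_; _⊎-dec_)
open import Relation.Unary using (Decidable)

T-∧-intro : ∀ x {y} → T x → T y → T (x ∧ y)
T-∧-intro true _ Ty = Ty

T-∧-elim : ∀ x {y} → T (x ∧ y) → T x × T y
T-∧-elim true Ty = tt , Ty

≢-split : ∀ {x y : Bool} → x ≢ y → (T x × T (not y)) ⊎ (T y × T (not x))
≢-split {true}  {true}  x≢y = ⊥-elim (x≢y refl)
≢-split {true}  {false} _   = inj₁ (tt , tt)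
≢-split {false} {true}  _   = inj₂ (tt , tt)
≢-split {false} {false} x≢y = ⊥-elim (x≢y refl)

⌊⌋-yes : ∀ {X : Set} (x? : Dec X) → X → ⌊ x? ⌋ ≡ true
⌊⌋-yes x? x = trans (isYes≗does x?) (dec-true x? x)

⌊⌋-no : ∀ {X : Set} (x? : Dec X) → ¬ X → ⌊ x? ⌋ ≡ false
⌊⌋-no x? ¬x = trans (isYes≗does x?) (dec-false x? ¬x)

==-refl : ∀ {n} (i : Fin n) → (i == i) ≡ true
==-refl i = ⌊⌋-yes (i F.≟ i) refl

==-≢ : ∀ {n} {i i' : Fin n} → i ≢ i' → (i == i') ≡ false
==-≢ = ⌊⌋-no (_ F.≟ _)

*-suc-≤ : ∀ {m n} → m ≤ n → m * suc n ≤ suc m * n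
*-suc-≤ {m} {n} m≤n = ≤-trans (≤-reflexive (*-suc m n)) (+-monoˡ-≤ (m * n) m≤n)

exponent-form : ∀ d r → (d + 2) ^ (r + 1) ≡ suc (suc d) ^ suc r
exponent-form d r = cong₂ _^_ (+-comm d 2) (+-comm r 1)

module _ {A : Set} where

  count : (A → Bool) → List A → ℕ
  count φ xs = length (filterᵇ φ xs)

  count-mono : ∀ {φ ψ : A → Bool} xs → (∀ {x} → x ∈ xs → T (φ x) → T (ψ x)) →
               count φ xs ≤ count ψ xs
  count-mono [] _ = z≤n
  count-mono {φ} {ψ} (x ∷ xs) φ⇒ψ with φ x | ψ x | φ⇒ψ (here refl)
  ... | true  | true  | _   = s≤s (count-mono xs (φ⇒ψ ∘ there))
  ... | true  | false | φ⇒ψ₀ = ⊥-elim (φ⇒ψ₀ tt)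
  ... | false | true  | _   = m≤n⇒m≤1+n (count-mono xs (φ⇒ψ ∘ there))
  ... | false | false | _   = count-mono xs (φ⇒ψ ∘ there)

  count-∨ : ∀ (φ ψ : A → Bool) xs → count (λ x → φ x ∨ ψ x) xs ≤ count φ xs + count ψ xs
  count-∨ φ ψ [] = z≤n
  count-∨ φ ψ (x ∷ xs) with φ x | ψ x
  ... | true  | true  = s≤s (≤-trans (count-∨ φ ψ xs) (+-mono-≤ ≤-refl (n≤1+n _)))
  ... | true  | false = s≤s (count-∨ φ ψ xs)
  ... | false | true  = ≤-trans (s≤s (count-∨ φ ψ xs)) (≤-reflexive (sym (+-suc _ _)))
  ... | false | false = count-∨ φ ψ xs

  count-all-but-one : ∀ {φ ψ : A → Bool} {xs} → Unique xs →
    (∀ {x y} → x ≢ y → T (φ x) → T (φ y) → T (ψ x) ⊎ T (ψ y)) →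
    count φ xs ≤ suc (count ψ xs)
  count-all-but-one {xs = []} _ _ = z≤n
  count-all-but-one {φ} {ψ} {x ∷ xs} (x∉xs ∷ unique) pair with φ x | ψ x | pair {x}
  ... | false | false | _ = count-all-but-one unique pair
  ... | false | true  | _ = m≤n⇒m≤1+n (count-all-but-one unique pair)
  ... | true  | true  | _ = s≤s (count-all-but-one unique pair)
  ... | true  | false | pairₓ =
    s≤s (count-mono xs λ y∈xs φy → [ (λ ()) , id ] (pairₓ (lookupAll x∉xs y∈xs) tt φy))

  count-none : ∀ {φ : A → Bool} xs → (∀ {x} → x ∈ xs → ¬ T (φ x)) → count φ xs ≡ 0
  count-none [] _ = refl
  count-none {φ} (x ∷ xs) ¬φ with φ x | ¬φ (here refl)
  ... | true  | ¬φx = ⊥-elim (¬φx tt)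
  ... | false | _   = count-none xs (¬φ ∘ there)

  count-all : ∀ {φ : A → Bool} xs → (∀ {x} → x ∈ xs → T (φ x)) → count φ xs ≡ length xs
  count-all [] _ = refl
  count-all {φ} (x ∷ xs) all-φ with φ x | all-φ (here refl)
  ... | true  | _ = cong suc (count-all xs (all-φ ∘ there))
  ... | false | ()

  count-≤1 : ∀ {φ : A → Bool} {xs} → Unique xs →
             (∀ {x y} → T (φ x) → T (φ y) → x ≡ y) → count φ xs ≤ 1
  count-≤1 {xs = xs} unique φ-unique =
    ≤-trans (count-all-but-one {ψ = λ _ → false} unique
               λ x≢y φx φy → ⊥-elim (x≢y (φ-unique φx φy)))
            (s≤s (≤-reflexive (count-none xs λ _ ())))

  module _ {B : Set} (_≟_ : DecidableEquality B) where
    open import Data.List.Membership.DecPropositional _≟_ using (_∈?_)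

    ∈?-∷ : ∀ y z S → ⌊ y ∈? z ∷ S ⌋ ≡ ⌊ y ≟ z ⌋ ∨ ⌊ y ∈? S ⌋
    ∈?-∷ y z S with y ≟ z | y ∈? S
    ... | yes _ | _     = refl
    ... | no _  | yes _ = refl
    ... | no _  | no _  = refl

    count-preimage : ∀ (φ : A → Bool) (f : A → B) xs S {c} →
      (∀ z → count (λ x → φ x ∧ ⌊ f x ≟ z ⌋) xs ≤ c) →
      count (λ x → φ x ∧ ⌊ f x ∈? S ⌋) xs ≤ length S * c
    count-preimage φ f xs [] _ =
      ≤-reflexive (count-none xs λ {x} _ φx∧false → proj₂ (T-∧-elim (φ x) φx∧false))
    count-preimage φ f xs (z ∷ S) {c} fibre = begin
      count (λ x → φ x ∧ ⌊ f x ∈? z ∷ S ⌋) xs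
        ≤⟨ count-mono xs (λ {x} _ →
             subst T (trans (cong (φ x ∧_) (∈?-∷ (f x) z S)) (∧-distribˡ-∨ (φ x) _ _))) ⟩
      count (λ x → (φ x ∧ ⌊ f x ≟ z ⌋) ∨ (φ x ∧ ⌊ f x ∈? S ⌋)) xs
        ≤⟨ count-∨ _ _ xs ⟩
      count (λ x → φ x ∧ ⌊ f x ≟ z ⌋) xs + count (λ x → φ x ∧ ⌊ f x ∈? S ⌋) xs
        ≤⟨ +-mono-≤ (fibre z) (count-preimage φ f xs S fibre) ⟩
      c + length S * c ∎
      where open ≤-Reasoning

Separates : ∀ {N n} → Graph N → (Fin n → Fin N) → (Fin n → Fin N) → Set
Separates G f g = ∀ {j' j} → j' F.< j → G (f j') (g j) ≢ G (f j) (g j)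

data Chain {N n} (G : Graph N) (P : Labelling N) : ℕ → (Fin n → Fin N) → Set where
  end : ∀ {f} → (∀ {j j'} → P (f j) ≡ P (f j') → j ≡ j') → Chain G P 0 f
  _∷_ : ∀ {m f g} → Separates G f g → Chain G P m g → Chain G P (suc m) f

module ContractionStep {N : ℕ} (G : Graph N) {P Q : Labelling N} (merge : MergeStep P Q)
                       {d : ℕ} (red-bounded : ∀ ℓ → redDeg G Q ℓ ≤ d) where

  open import Data.List.Membership.DecPropositional (F._≟_ {N}) using (_∈?_)

  N[_] : Fin N → List (Fin N)
  N[ ℓ ] = ℓ ∷ filterᵇ (isRed G Q ℓ) (allV N)

  length-N : ∀ ℓ → length N[ ℓ ] ≤ suc d
  length-N ℓ = s≤s (red-bounded ℓ)

  private
    T-any² : ∀ (χ : Fin N → Fin N → Bool) {u v} → T (χ u v) →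
             T (any (λ u → any (χ u) (allV N)) (allV N))
    T-any² χ {u} {v} χuv = any⁺ _ (lose (∈-allFin u) (any⁺ _ (lose (∈-allFin v) χuv)))

  isRed-intro : ∀ {ℓ m u v u' v'} → ℓ ≢ m → Q u ≡ ℓ → Q v ≡ m → T (G u v) →
                Q u' ≡ ℓ → Q v' ≡ m → T (not (G u' v')) → T (isRed G Q ℓ m)
  isRed-intro {ℓ} {m} {u} {v} {u'} {v'} ℓ≢m Qu Qv edge Qu' Qv' non-edge =
    T-∧-intro (not (ℓ == m)) (fromWitnessFalse ℓ≢m)
      (T-∧-intro (any (λ u → any (has-edge u) (allV N)) (allV N))
        (T-any² has-edge
          (T-∧-intro (Q u == ℓ) (fromWitness Qu) (T-∧-intro (Q v == m) (fromWitness Qv) edge)))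
        (T-any² has-non-edge
          (T-∧-intro (Q u' == ℓ) (fromWitness Qu') (T-∧-intro (Q v' == m) (fromWitness Qv') non-edge))))
    where
    has-edge has-non-edge : Fin N → Fin N → Bool
    has-edge u v = (Q u == ℓ) ∧ (Q v == m) ∧ G u v
    has-non-edge u v = (Q u == ℓ) ∧ (Q v == m) ∧ not (G u v)

  distinguished-∈-N : ∀ {u v z} → Q u ≡ Q v → G u z ≢ G v z → Q z ∈ N[ Q u ]
  distinguished-∈-N {u} {v} {z} Qu≡Qv Guz≢Gvz with Q z F.≟ Q u
  ... | yes Qz≡Qu = here Qz≡Qu
  ... | no Qz≢Qu = there (∈-filter⁺ (T? ∘ isRed G Q (Q u)) (∈-allFin (Q z)) red)
    where
    red : T (isRed G Q (Q u) (Q z))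
    red with ≢-split Guz≢Gvz
    ... | inj₁ (uz , ¬vz) = isRed-intro (Qz≢Qu ∘ sym) refl refl uz (sym Qu≡Qv) refl ¬vz
    ... | inj₂ (vz , ¬uz) = isRed-intro (Qz≢Qu ∘ sym) (sym Qu≡Qv) refl vz refl refl ¬uz

  private
    y : Fin N
    y = proj₁ (proj₂ merge)

  same-Q-part⇒same-P-part : ∀ {u v} → Q u ≡ Q v → P u ≢ P y → P v ≢ P y → P u ≡ P v
  same-Q-part⇒same-P-part {u} {v} Qu≡Qv Pu≢Py Pv≢Py
    with Equivalence.to (proj₂ (proj₂ (proj₂ merge)) u v) Qu≡Qv
  ... | inj₁ Pu≡Pv = Pu≡Pv
  ... | inj₂ (inj₁ (_ , Pv≡Py)) = ⊥-elim (Pv≢Py Pv≡Py)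
  ... | inj₂ (inj₂ (Pu≡Py , _)) = ⊥-elim (Pu≢Py Pu≡Py)

  module _ {n : ℕ} where

    Capped : ℕ → (Fin n → Fin N) → Set
    Capped c f = ∀ ℓ → count (λ j → ⌊ Q (f j) ∈? N[ ℓ ] ⌋) (allFin n) ≤ c

    -- If j < j' lie in the fibre of Q ∘ f over m, then g j' separates f j from f j', so g j' lies
    -- in N[ m ]; hence every fibre has at most c + 1 members.
    separated-capped : ∀ {c f g} → Separates G f g → Capped c g → Capped (suc d * suc c) f
    separated-capped {c} {f} {g} separates g-capped ℓ =
      ≤-trans (count-preimage F._≟_ (λ _ → true) (Q ∘ f) (allFin n) N[ ℓ ] fibre)
              (*-monoˡ-≤ (suc c) (length-N ℓ))
      where
      fibre : ∀ m → count (λ j → ⌊ Q (f j) F.≟ m ⌋) (allFin n) ≤ suc c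
      fibre m = ≤-trans (count-all-but-one (allFin⁺ n) later-∈-N) (s≤s (g-capped m))
        where
        ∈-N : ∀ {j j'} → j F.< j' → Q (f j) ≡ m → Q (f j') ≡ m → T ⌊ Q (g j') ∈? N[ m ] ⌋
        ∈-N j<j' Qfj Qfj' = fromWitness (subst (λ ℓ → _ ∈ N[ ℓ ]) Qfj
                                           (distinguished-∈-N (trans Qfj (sym Qfj')) (separates j<j')))
        later-∈-N : ∀ {j j'} → j ≢ j' → T ⌊ Q (f j) F.≟ m ⌋ → T ⌊ Q (f j') F.≟ m ⌋ →
                    T ⌊ Q (g j) ∈? N[ m ] ⌋ ⊎ T ⌊ Q (g j') ∈? N[ m ] ⌋
        later-∈-N {j} {j'} j≢j' Qfj Qfj' with FP.<-cmp j j'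
        ... | tri< j<j' _ _ = inj₂ (∈-N j<j' (toWitness Qfj) (toWitness Qfj'))
        ... | tri≈ _ j≡j' _ = ⊥-elim (j≢j' j≡j')
        ... | tri> _ _ j'<j = inj₁ (∈-N j'<j (toWitness Qfj') (toWitness Qfj))

    -- Away from the part of y the parts of Q are parts of P, which f meets at most once each.
    injective-capped : ∀ {f} → (∀ {j j'} → P (f j) ≡ P (f j') → j ≡ j') →
                       Capped (suc (suc d)) f
    injective-capped {f} f-injective ℓ = begin
      count (λ j → ⌊ Q (f j) ∈? N[ ℓ ] ⌋) (allFin n)
        ≤⟨ count-all-but-one (allFin⁺ n) one-outside-y ⟩
      suc (count (λ j → not (P (f j) == P y) ∧ ⌊ Q (f j) ∈? N[ ℓ ] ⌋) (allFin n))
        ≤⟨ s≤s (count-preimage F._≟_ _ (Q ∘ f) (allFin n) N[ ℓ ] fibre) ⟩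
      suc (length N[ ℓ ] * 1)
        ≡⟨ cong suc (*-identityʳ _) ⟩
      suc (length N[ ℓ ])
        ≤⟨ s≤s (length-N ℓ) ⟩
      suc (suc d) ∎
      where
      open ≤-Reasoning
      one-outside-y : ∀ {j j'} → j ≢ j' →
                      T ⌊ Q (f j) ∈? N[ ℓ ] ⌋ → T ⌊ Q (f j') ∈? N[ ℓ ] ⌋ →
                      T (not (P (f j) == P y) ∧ ⌊ Q (f j) ∈? N[ ℓ ] ⌋) ⊎
                      T (not (P (f j') == P y) ∧ ⌊ Q (f j') ∈? N[ ℓ ] ⌋)
      one-outside-y {j} {j'} j≢j' fj fj' with P (f j) F.≟ P y
      ... | no _ = inj₁ fj
      ... | yes Pfj≡Py = inj₂ (T-∧-intro (not (P (f j') == P y))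
              (fromWitnessFalse (λ Pfj'≡Py → j≢j' (f-injective (trans Pfj≡Py (sym Pfj'≡Py))))) fj')
      fibre : ∀ m → count (λ j → not (P (f j) == P y) ∧ ⌊ Q (f j) F.≟ m ⌋) (allFin n) ≤ 1
      fibre m = count-≤1 (allFin⁺ n) λ {j} {j'} fj fj' →
        let (Pfj≢Py , Qfj≡m) = T-∧-elim (not (P (f j) == P y)) fj
            (Pfj'≢Py , Qfj'≡m) = T-∧-elim (not (P (f j') == P y)) fj'
        in f-injective (same-Q-part⇒same-P-part (trans (toWitness Qfj≡m) (sym (toWitness Qfj'≡m)))
                          (toWitnessFalse Pfj≢Py) (toWitnessFalse Pfj'≢Py))

    chain-capped : ∀ {m f} → Chain G P m f → Capped (suc (suc d) ^ suc m) f
    chain-capped (end f-injective) ℓ =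
      ≤-trans (injective-capped f-injective ℓ) (≤-reflexive (sym (*-identityʳ _)))
    chain-capped {suc m} (separates ∷ chain) ℓ =
      ≤-trans (separated-capped separates (chain-capped chain) ℓ)
              (*-suc-≤ (≤-trans (n≤1+n _) (m≤m*n (suc (suc d)) (suc (suc d) ^ m) {{m^n≢0 _ m}})))

    chain-bound : ∀ {m f u v} → Chain G P m f → Q u ≡ Q v → (∀ j → G u (f j) ≢ G v (f j)) →
                  n ≤ suc (suc d) ^ suc m
    chain-bound {m} {f} {u} chain Qu≡Qv distinguishes = begin
      n
        ≡⟨ sym (length-tabulate id) ⟩
      length (allFin n)
        ≡⟨ sym (count-all (allFin n) λ {j} _ →
                  fromWitness (distinguished-∈-N Qu≡Qv (distinguishes j))) ⟩
      count (λ j → ⌊ Q (f j) ∈? N[ Q u ] ⌋) (allFin n)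
        ≤⟨ chain-capped chain (Q u) ⟩
      suc (suc d) ^ suc m ∎
      where open ≤-Reasoning

Merges : ∀ {N n} → Labelling N → (Fin n → Fin N) → Set
Merges P f = ∃₂ λ i i' → i F.< i' × P (f i) ≡ P (f i')

merges? : ∀ {N n} (P : Labelling N) (f : Fin n → Fin N) → Dec (Merges P f)
merges? P f = FP.any? λ i → FP.any? λ i' → (i F.<? i') ×-dec (P (f i) F.≟ P (f i'))

¬merges⇒injective : ∀ {N n} {P : Labelling N} {f : Fin n → Fin N} → ¬ Merges P f →
                    ∀ {i i'} → P (f i) ≡ P (f i') → i ≡ i'
¬merges⇒injective ¬merges {i} {i'} Pfi≡Pfi' with FP.<-cmp i i'
... | tri< i<i' _ _ = ⊥-elim (¬merges (i , i' , i<i' , Pfi≡Pfi'))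
... | tri≈ _ i≡i' _ = i≡i'
... | tri> _ _ i'<i = ⊥-elim (¬merges (i' , i , i'<i , sym Pfi≡Pfi'))

injective⇒¬merges : ∀ {N n} {P : Labelling N} {f : Fin n → Fin N} → IsDiscrete P →
                    (∀ {i i'} → f i ≡ f i' → i ≡ i') → ¬ Merges P f
injective⇒¬merges P-injective f-injective (i , i' , i<i' , Pfi≡Pfi') =
  FP.<⇒≢ i<i' (f-injective (P-injective Pfi≡Pfi'))

first-step : ∀ {len} {R : Fin (suc len) → Set} → Decidable R → ¬ R F.zero → R (F.fromℕ len) →
             ∃ λ s → ¬ R (F.inject₁ s) × R (F.suc s)
first-step {zero} _ ¬R₀ R-last = ⊥-elim (¬R₀ R-last)
first-step {suc len} R? ¬R₀ R-last with R? (F.suc F.zero)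
... | yes R₁ = F.zero , ¬R₀ , R₁
... | no ¬R₁ with first-step (R? ∘ F.suc) ¬R₁ R-last
...   | s , ¬Rs , Rs+1 = F.suc s , ¬Rs , Rs+1

attaches : ∀ {n} → Kind → Fin n → Fin n → Bool
attaches halfgraph = leF
attaches _         = _==_

attaches-refl : ∀ k {n} (i : Fin n) → attaches k i i ≡ true
attaches-refl star      i = ⌊⌋-yes (i F.≟ i) refl
attaches-refl clique    i = ⌊⌋-yes (i F.≟ i) refl
attaches-refl halfgraph i = ⌊⌋-yes (i F.≤? i) FP.≤-refl

attaches-< : ∀ k {n} {i i' : Fin n} → i' F.< i → attaches k i i' ≡ false
attaches-< star      i'<i = ⌊⌋-no (_ F.≟ _) (FP.<⇒≢ i'<i ∘ sym)
attaches-< clique    i'<i = ⌊⌋-no (_ F.≟ _) (FP.<⇒≢ i'<i ∘ sym)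
attaches-< halfgraph i'<i = ⌊⌋-no (_ F.≤? _) (<⇒≱ i'<i)

module _ {n r : ℕ} where

  crossAdj-sym : ∀ k (u v : CV n r) → crossAdj k u v ≡ crossAdj k v u
  crossAdj-sym k u v = ∨-comm (edge→ k u v) (edge→ k v u)

  crossAdj-p-a : ∀ k (i j i' : Fin n) {t : Fin r} → toℕ t ≡ 0 →
                 crossAdj k (p i j t) (a i') ≡ attaches k i' i
  crossAdj-p-a star      _ _ _ t≡0 rewrite ⌊⌋-yes (_ ℕ.≟ _) t≡0 = ∧-identityʳ _
  crossAdj-p-a clique    _ _ _ t≡0 rewrite ⌊⌋-yes (_ ℕ.≟ _) t≡0 = ∧-identityʳ _
  crossAdj-p-a halfgraph _ _ _ t≡0 rewrite ⌊⌋-yes (_ ℕ.≟ _) t≡0 = ∧-identityʳ _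

  crossAdj-p-b : ∀ k (i j j' : Fin n) {t : Fin r} → suc (toℕ t) ≡ r →
                 crossAdj k (p i j t) (b j') ≡ attaches k j' j
  crossAdj-p-b star      _ _ _ t-last rewrite ⌊⌋-yes (_ ℕ.≟ _) t-last = ∧-identityʳ _
  crossAdj-p-b clique    _ _ _ t-last rewrite ⌊⌋-yes (_ ℕ.≟ _) t-last = ∧-identityʳ _
  crossAdj-p-b halfgraph _ _ _ t-last rewrite ⌊⌋-yes (_ ℕ.≟ _) t-last = ∧-identityʳ _

  module _ {s t : Fin r} (t≡1+s : toℕ t ≡ suc (toℕ s)) where

    succF-step : succF s t ≡ true
    succF-step = ⌊⌋-yes (_ ℕ.≟ _) (sym t≡1+s)

    isFirst-step : isFirst t ≡ false
    isFirst-step = ⌊⌋-no (_ ℕ.≟ _) (1+n≢0 ∘ trans (sym t≡1+s))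

    isLast-step : isLast s ≡ false
    isLast-step = ⌊⌋-no (_ ℕ.≟ _) λ 1+s≡r → <-irrefl (trans t≡1+s 1+s≡r) (FP.toℕ<n t)

    p-≢-step : ∀ {i j i' j' : Fin n} → p i j s ≢ p i' j' t
    p-≢-step refl = 1+n≢n (sym t≡1+s)

    crossAdj-step-same : ∀ k (i j : Fin n) → crossAdj k (p i j s) (p i j t) ≡ true
    crossAdj-step-same star      i j rewrite ==-refl i | ==-refl j | succF-step = refl
    crossAdj-step-same clique    i j rewrite ==-refl i | ==-refl j | succF-step = refl
    crossAdj-step-same halfgraph i j rewrite ==-refl i | ==-refl j | succF-step = refl

    crossAdj-step-row : ∀ k (i : Fin n) {j j'} → j ≢ j' → crossAdj k (p i j s) (p i j' t) ≡ false
    crossAdj-step-row star      i j≢j' rewrite ==-refl i | ==-≢ j≢j' | ==-≢ (j≢j' ∘ sym) = refl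
    crossAdj-step-row halfgraph i j≢j' rewrite ==-refl i | ==-≢ j≢j' | ==-≢ (j≢j' ∘ sym) = refl
    crossAdj-step-row clique    i j≢j'
      rewrite ==-refl i | ==-≢ j≢j' | ==-≢ (j≢j' ∘ sym) | isFirst-step | ∧-zeroʳ (isFirst s)
      = refl

    crossAdj-step-column : ∀ k {i i'} (j : Fin n) → i ≢ i' → crossAdj k (p i j s) (p i' j t) ≡ false
    crossAdj-step-column star      j i≢i' rewrite ==-≢ i≢i' | ==-≢ (i≢i' ∘ sym) = refl
    crossAdj-step-column halfgraph j i≢i' rewrite ==-≢ i≢i' | ==-≢ (i≢i' ∘ sym) = refl
    crossAdj-step-column clique    j i≢i'
      rewrite ==-≢ i≢i' | ==-≢ (i≢i' ∘ sym) | ==-refl j | isLast-step | ∧-zeroʳ (isLast t)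
      = refl

module Crossing {n r N : ℕ} (k : Kind)
                (Fl : Fin (suc (suc (suc r))) → Fin (suc (suc (suc r))) → Bool)
                (e : Fin N ⤖ CV n (suc r)) where

  G : Graph N
  G = flippedAdj k Fl e

  vertex : CV n (suc r) → Fin N
  vertex = Bijection.to⁻ e

  to∘vertex : ∀ c → Bijection.to e (vertex c) ≡ c
  to∘vertex = Surjection.to∘to⁻ (Bijection.surjection e)

  vertex-injective : ∀ {c c'} → vertex c ≡ vertex c' → c ≡ c'
  vertex-injective {c} {c'} eq =
    trans (sym (to∘vertex c)) (trans (cong (Bijection.to e) eq) (to∘vertex c'))

  G-vertex : ∀ {c c'} → c ≢ c' →
             G (vertex c) (vertex c') ≡ crossAdj k c c' xor Fl (layer c) (layer c')
  G-vertex {c} {c'} c≢c'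
    rewrite ⌊⌋-no (vertex c F.≟ vertex c') (c≢c' ∘ vertex-injective)
          | to∘vertex c | to∘vertex c' = refl

  -- The flip toggles the adjacency of z to c and to c' alike, as c and c' share a layer.
  G-differs : ∀ {c c' z} → layer c ≡ layer c' → c ≢ z → c' ≢ z →
              crossAdj k c z ≡ false → crossAdj k c' z ≡ true →
              G (vertex c) (vertex z) ≢ G (vertex c') (vertex z)
  G-differs layer≡ c≢z c'≢z cz c'z
    rewrite G-vertex c≢z | G-vertex c'≢z | layer≡ | cz | c'z = not-¬ refl

  as bs : Fin n → Fin N
  as i = vertex (a i)
  bs j = vertex (b j)

  row column : Fin n → Fin (suc r) → Fin n → Fin N
  row i s j = vertex (p i j s)
  column j s i = vertex (p i j s)

  row-step : ∀ {i s t} → toℕ t ≡ suc (toℕ s) → Separates G (row i s) (row i t)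
  row-step {i} t≡1+s j'<j =
    G-differs refl (p-≢-step t≡1+s) (p-≢-step t≡1+s)
      (crossAdj-step-row t≡1+s k i (FP.<⇒≢ j'<j)) (crossAdj-step-same t≡1+s k i _)

  row-end : ∀ {i s} → suc (toℕ s) ≡ suc r → Separates G (row i s) bs
  row-end {i} s-last {j'} {j} j'<j =
    G-differs refl (λ ()) (λ ())
      (trans (crossAdj-p-b k i j' j s-last) (attaches-< k j'<j))
      (trans (crossAdj-p-b k i j j s-last) (attaches-refl k j))

  row-top : ∀ {i i' s} → i F.< i' → toℕ s ≡ 0 →
            ∀ j → G (as i) (row i s j) ≢ G (as i') (row i s j)
  row-top {i} {i'} i<i' s-first j =
    ≢-sym (G-differs refl (λ ()) (λ ())
      (trans (crossAdj-sym k _ _) (trans (crossAdj-p-a k i j i' s-first) (attaches-< k i<i')))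
      (trans (crossAdj-sym k _ _) (trans (crossAdj-p-a k i j i s-first) (attaches-refl k i))))

  column-step : ∀ {j s t} → toℕ s ≡ suc (toℕ t) → Separates G (column j s) (column j t)
  column-step {j} s≡1+t i'<i =
    G-differs refl (p-≢-step s≡1+t ∘ sym) (p-≢-step s≡1+t ∘ sym)
      (trans (crossAdj-sym k _ _) (crossAdj-step-column s≡1+t k j (FP.<⇒≢ i'<i ∘ sym)))
      (trans (crossAdj-sym k _ _) (crossAdj-step-same s≡1+t k _ j))

  column-end : ∀ {j s} → toℕ s ≡ 0 → Separates G (column j s) as
  column-end {j} s-first {i'} {i} i'<i =
    G-differs refl (λ ()) (λ ())
      (trans (crossAdj-p-a k i' j i s-first) (attaches-< k i'<i))
      (trans (crossAdj-p-a k i j i s-first) (attaches-refl k i))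

  column-top : ∀ {j j' s} → j F.< j' → suc (toℕ s) ≡ suc r →
               ∀ i → G (bs j) (column j s i) ≢ G (bs j') (column j s i)
  column-top {j} {j'} j<j' s-last i =
    ≢-sym (G-differs refl (λ ()) (λ ())
      (trans (crossAdj-sym k _ _) (trans (crossAdj-p-b k i j j' s-last) (attaches-< k j<j')))
      (trans (crossAdj-sym k _ _) (trans (crossAdj-p-b k i j j s-last) (attaches-refl k j))))

  row-chain : ∀ {P} i → (∀ {j j'} → P (bs j) ≡ P (bs j') → j ≡ j') →
              ∀ m s → m + toℕ s ≡ r → Chain G P (suc m) (row i s)
  row-chain i bs-injective zero    s s≡r = row-end (cong suc s≡r) ∷ end bs-injective
  row-chain i bs-injective (suc m) s 1+m+s≡r =
    row-step (FP.toℕ-fromℕ< 1+s<1+r) ∷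
    row-chain i bs-injective m (F.fromℕ< 1+s<1+r)
      (trans (cong (m +_) (FP.toℕ-fromℕ< 1+s<1+r)) (trans (+-suc m (toℕ s)) 1+m+s≡r))
    where
    1+s<1+r : suc (toℕ s) ℕ.< suc r
    1+s<1+r = s≤s (subst (suc (toℕ s) ≤_) 1+m+s≡r (s≤s (m≤n+m (toℕ s) m)))

  column-chain : ∀ {P} j → (∀ {i i'} → P (as i) ≡ P (as i') → i ≡ i') →
                 ∀ m s → toℕ s ≡ m → Chain G P (suc m) (column j s)
  column-chain j as-injective zero    s s≡0 = column-end s≡0 ∷ end as-injective
  column-chain j as-injective (suc m) s s≡1+m =
    column-step (trans s≡1+m (cong suc (sym (FP.toℕ-fromℕ< m<1+r)))) ∷
    column-chain j as-injective m (F.fromℕ< m<1+r) (FP.toℕ-fromℕ< m<1+r)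
    where
    m<1+r : m ℕ.< suc r
    m<1+r = <-trans (n<1+n m) (subst (ℕ._< suc r) s≡1+m (FP.toℕ<n s))

  Collapsed : Labelling N → Set
  Collapsed P = Merges P as ⊎ Merges P bs

  collapse-bound : ∀ {P Q d} → MergeStep P Q → (∀ ℓ → redDeg G Q ℓ ≤ d) →
                   ¬ Collapsed P → Collapsed Q → n ≤ suc (suc d) ^ suc (suc r)
  collapse-bound {P} merge red-bounded ¬collapsed (inj₁ (i , i' , i<i' , Qai≡Qai')) =
    chain-bound (row-chain i bs-injective r F.zero (+-identityʳ r)) Qai≡Qai' (row-top i<i' refl)
    where
    open ContractionStep G merge red-bounded
    bs-injective : ∀ {j j'} → P (bs j) ≡ P (bs j') → j ≡ j'
    bs-injective = ¬merges⇒injective {P = P} {f = bs} (¬collapsed ∘ inj₂)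
  collapse-bound {P} merge red-bounded ¬collapsed (inj₂ (j , j' , j<j' , Qbj≡Qbj')) =
    chain-bound (column-chain j as-injective r (F.fromℕ r) (FP.toℕ-fromℕ r))
                Qbj≡Qbj' (column-top j<j' (cong suc (FP.toℕ-fromℕ r)))
    where
    open ContractionStep G merge red-bounded
    as-injective : ∀ {i i'} → P (as i) ≡ P (as i') → i ≡ i'
    as-injective = ¬merges⇒injective {P = P} {f = as} (¬collapsed ∘ inj₁)

  contraction-bound : ∀ {d} → ContractionSeq G d → ∀ {i₀ i₁ : Fin n} → i₀ F.< i₁ →
                      n ≤ suc (suc d) ^ suc (suc r)
  contraction-bound cs i₀<i₁ =
    let s , ¬collapsed , collapsed = first-step collapsed? discrete-uncollapsed trivial-collapsed
    in  collapse-bound (steps s) (redBound (F.suc s)) ¬collapsed collapsed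
    where
    open ContractionSeq cs
    collapsed? : ∀ s → Dec (Collapsed (part s))
    collapsed? s = merges? (part s) as ⊎-dec merges? (part s) bs
    discrete-uncollapsed : ¬ Collapsed (part F.zero)
    discrete-uncollapsed = [ injective⇒¬merges start (λ eq → a-injective (vertex-injective eq))
                           , injective⇒¬merges start (λ eq → b-injective (vertex-injective eq)) ]
      where
      a-injective : ∀ {i i'} → a {n} {suc r} i ≡ a i' → i ≡ i'
      a-injective refl = refl
      b-injective : ∀ {j j'} → b {n} {suc r} j ≡ b j' → j ≡ j'
      b-injective refl = refl
    trivial-collapsed : Collapsed (part (F.fromℕ len))
    trivial-collapsed = inj₁ (_ , _ , i₀<i₁ , finish _ _)

lemma15p1 : (r n : ℕ) → 1 ≤ r → 1 ≤ n → (k : Kind)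
    → (Fl : Fin (suc (suc r)) → Fin (suc (suc r)) → Bool) → SymmetricF Fl
    → (N : ℕ) → (e : Fin N ⤖ CV n r)
    → (d : ℕ) → TwwAtMost (flippedAdj k Fl e) d
    → n ≤ (d + 2) ^ (r + 1)
lemma15p1 (suc r) 1 _ _ _ _ _ _ _ d _ =
  subst (1 ≤_) (sym (exponent-form d (suc r))) (m^n>0 (suc (suc d)) (suc (suc r)))
lemma15p1 (suc r) (suc (suc n)) _ _ k Fl _ _ e d cs =
  subst (suc (suc n) ≤_) (sym (exponent-form d (suc r)))
        (Crossing.contraction-bound k Fl e cs {F.zero} {F.suc F.zero} z<s)
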